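{- Let $s>t\geq 1$ be integers. Then the distinguishing chromatic index of the complete bipartite graph $K_{s,t}$ is $\chi'_D(K_{s,t})=s$.
   Context: All graphs are finite and simple. A proper edge labeling of $G$ assigns labels to the edges so that any two edges sharing an endpoint receive different labels. An automorphism $f$ of $G$ preserves an edge labeling $c$ if $c(\{f(u),f(v)\})=c(\{u,v\})$ for every edge $\{u,v\}$. The distinguishing chromatic index $\chi'_D(G)$ is the least number $d$ such that $G$ has a proper edge labeling with $d$ labels that is preserved only by the identity automorphism of $G$. -}

module Defs where

open import Level using (0ℓ)
open import Data.Nat using (ℕ; _+_; _<_; _≤_)
open import Data.Fin using (Fin; toℕ)
open import Data.Fin.Permutation using (Permutation′; _⟨$⟩ʳ_)
open import Data.Product using (Σ; _×_; _,_)
open import Data.Sum using (_⊎_)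
open import Data.Empty using (⊥)
open import Relation.Nullary using (¬_)
open import Relation.Binary.PropositionalEquality using (_≡_; _≢_)

record Graph : Set₁ where
  field
    n     : ℕ
    Adj   : Fin n → Fin n → Set
    sym   : ∀ {u v} → Adj u v → Adj v u
    irrefl : ∀ {u} → ¬ Adj u u
open Graph public

IsAutomorphism : (G : Graph) → Permutation′ (n G) → Set
IsAutomorphism G f = ∀ u v → (Adj G u v → Adj G (f ⟨$⟩ʳ u) (f ⟨$⟩ʳ v))
                           × (Adj G (f ⟨$⟩ʳ u) (f ⟨$⟩ʳ v) → Adj G u v)

-- An edge labeling with (at most) d labels {0,…,d-1}: a label for each ordered
-- pair of vertices, which on edges does not depend on the orientation
-- (values on non-adjacent pairs are irrelevant).
EdgeLabeling : Graph → ℕ → Set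
EdgeLabeling G d = Fin (n G) → Fin (n G) → Fin d

IsEdgeLabeling : (G : Graph) {d : ℕ} → EdgeLabeling G d → Set
IsEdgeLabeling G c = ∀ u v → Adj G u v → c u v ≡ c v u

IsProper : (G : Graph) {d : ℕ} → EdgeLabeling G d → Set
IsProper G c = ∀ u v w → Adj G u v → Adj G u w → v ≢ w → c u v ≢ c u w

Preserves : (G : Graph) {d : ℕ} → Permutation′ (n G) → EdgeLabeling G d → Set
Preserves G f c = ∀ u v → Adj G u v → c (f ⟨$⟩ʳ u) (f ⟨$⟩ʳ v) ≡ c u v

IsDistinguishing : (G : Graph) {d : ℕ} → EdgeLabeling G d → Set
IsDistinguishing G c = ∀ f → IsAutomorphism G f → Preserves G f c → ∀ v → f ⟨$⟩ʳ v ≡ v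

HasDistEdgeLabeling : Graph → ℕ → Set
HasDistEdgeLabeling G d =
  Σ (EdgeLabeling G d) λ c → IsEdgeLabeling G c × IsProper G c × IsDistinguishing G c

DistChromaticIndexIs : Graph → ℕ → Set
DistChromaticIndexIs G d =
  HasDistEdgeLabeling G d × (∀ d′ → d′ < d → ¬ HasDistEdgeLabeling G d′)

-- Complete bipartite graph K_{s,t} on Fin (s + t): vertices with index < s
-- form one side, the rest the other; edges are exactly the pairs across sides.
KAdj : (s t : ℕ) → Fin (s + t) → Fin (s + t) → Set
KAdj s t u v = (toℕ u < s × s ≤ toℕ v) ⊎ (s ≤ toℕ u × toℕ v < s)

private
  open import Data.Sum using (inj₁; inj₂)
  open import Data.Nat.Properties using (<⇒≱)

  KAdj-sym : ∀ s t {u v} → KAdj s t u v → KAdj s t v u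
  KAdj-sym s t (inj₁ (a , b)) = inj₂ (b , a)
  KAdj-sym s t (inj₂ (a , b)) = inj₁ (b , a)

  KAdj-irrefl : ∀ s t {u} → ¬ KAdj s t u u
  KAdj-irrefl s t (inj₁ (a , b)) = <⇒≱ a b
  KAdj-irrefl s t (inj₂ (a , b)) = <⇒≱ b a

K : ℕ → ℕ → Graph
K s t = record { n = s + t ; Adj = KAdj s t ; sym = KAdj-sym s t ; irrefl = KAdj-irrefl s t }

module Submission where

-- Lower bound: a vertex of the t-side sees all s vertices of the s-side, so a
-- proper labeling needs s labels (pigeonhole).
-- Upper bound: with coordinates i ∈ [0,s) on the side A and offsets
-- j ∈ [0,t) on the side B, label the edge {i, j} by (i + j) mod s; this is
-- proper since translation modulo s is injective.  A label-preserving
-- automorphism f fixes the sides (as t < s it cannot inject A into B).  If j₀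
-- is the offset of f⁻¹(b₀), the edges at b₀ show that f translates A by j₀,
-- and then the edges at 0 show that translation by j₀ modulo s maps [0,t)
-- onto [0,t); since t < s this forces j₀ = 0, so f is the identity.
-- The file proves the arithmetic modulo s and the degree bound for proper
-- labelings first, then the side-preservation of automorphisms of K_{s,t},
-- then the properties of the labeling, and derives the theorem at the end.

open import Defs hiding (sym)
open import Data.Nat.Base using (ℕ; zero; suc; _+_; _*_; _∸_; _<_; _≤_; z≤n; NonZero; >-nonZero; >-nonZero⁻¹)
open import Data.Nat.Properties
open import Data.Nat.DivMod using (_%_; _/_; m≡m%n+[m/n]*n; m%n<n; m<n⇒m%n≡m)
open import Data.Nat.Divisibility using (_∣_; divides; ∣⇒≤)
open import Data.Fin.Base using (Fin; toℕ; fromℕ<; _↑ˡ_; _↑ʳ_)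
open import Data.Fin.Properties using (toℕ-injective; toℕ-↑ˡ; toℕ-↑ʳ; toℕ<n; toℕ-fromℕ<; fromℕ<-injective; ↑ˡ-injective; injective⇒≤) renaming (_≟_ to _≟ᶠ_)
open import Data.Fin.Permutation using (Permutation′; _⟨$⟩ʳ_; _⟨$⟩ˡ_; inverseˡ; inverseʳ)
open import Data.Product using (∃-syntax; _×_; _,_; proj₁)
open import Data.Sum using (inj₁; inj₂)
open import Function.Definitions using (Injective)
open import Relation.Nullary using (¬_; yes; no)
open import Relation.Nullary.Decidable using (decidable-stable)
open import Relation.Nullary.Negation using (contradiction)
open import Relation.Binary.PropositionalEquality using (_≡_; refl; sym; trans; cong; cong₂; subst; module ≡-Reasoning)

%-≡⇒∣∸ : ∀ {s} .{{_ : NonZero s}} x y → x % s ≡ y % s → s ∣ x ∸ y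
%-≡⇒∣∸ {s} x y eq = divides (x / s ∸ y / s) (begin
  x ∸ y
    ≡⟨ cong₂ _∸_ (m≡m%n+[m/n]*n x s) (m≡m%n+[m/n]*n y s) ⟩
  (x % s + x / s * s) ∸ (y % s + y / s * s)
    ≡⟨ cong (λ r → (r + x / s * s) ∸ (y % s + y / s * s)) eq ⟩
  (y % s + x / s * s) ∸ (y % s + y / s * s)
    ≡⟨ [m+n]∸[m+o]≡n∸o (y % s) (x / s * s) (y / s * s) ⟩
  x / s * s ∸ y / s * s
    ≡⟨ sym (*-distribʳ-∸ s (x / s) (y / s)) ⟩
  (x / s ∸ y / s) * s ∎)
  where open ≡-Reasoning

∣∧<⇒≡0 : ∀ {s d} → s ∣ d → d < s → d ≡ 0
∣∧<⇒≡0 {d = zero}  _   _   = refl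
∣∧<⇒≡0 {d = suc _} s∣d d<s = contradiction (∣⇒≤ s∣d) (<⇒≱ d<s)

+-%-cancelˡ : ∀ {s} .{{_ : NonZero s}} k {x y} → x < s → y < s →
              (k + x) % s ≡ (k + y) % s → x ≡ y
+-%-cancelˡ {s} k {x} {y} x<s y<s eq = ≤-antisym (below x<s eq) (below y<s (sym eq))
  where
  -- the difference u ∸ v is a multiple of s smaller than s, hence zero
  below : ∀ {u v} → u < s → (k + u) % s ≡ (k + v) % s → u ≤ v
  below {u} {v} u<s same = m∸n≡0⇒m≤n (∣∧<⇒≡0
    (subst (s ∣_) ([m+n]∸[m+o]≡n∸o k u v) (%-≡⇒∣∸ (k + u) (k + v) same))
    (≤-<-trans (m∸n≤m u v) u<s))

+-%-cancelʳ : ∀ {s} .{{_ : NonZero s}} k {x y} → x < s → y < s →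
              (x + k) % s ≡ (y + k) % s → x ≡ y
+-%-cancelʳ {s} k {x} {y} x<s y<s eq = +-%-cancelˡ k x<s y<s
  (trans (cong (_% s) (+-comm k x)) (trans eq (cong (_% s) (+-comm y k))))

-- If the translates of [0,t) by j₀ modulo s cover [0,t), where j₀ < t < s,
-- then j₀ = 0: the residue j₀ - 1 could only come from s - 1 ∉ [0,t).
shift-covering⇒≡0 : ∀ {s t j₀} .{{_ : NonZero s}} → t < s → j₀ < t →
                    (∀ j → j < t → ∃[ x ] x < t × (j₀ + x) % s ≡ j) → j₀ ≡ 0
shift-covering⇒≡0 {j₀ = zero} _ _ _ = refl
shift-covering⇒≡0 {s} {t} {suc c} t<s j₀<t covers with covers c (<⇒≤ j₀<t)
... | x , x<t , hit = contradiction (+-%-cancelˡ c (≤-<-trans x<t t<s) (>-nonZero⁻¹ s) wraps) λ ()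
  where
  open ≡-Reasoning
  wraps : (c + suc x) % s ≡ (c + 0) % s
  wraps = begin
    (c + suc x) % s ≡⟨ cong (_% s) (+-suc c x) ⟩
    (suc c + x) % s ≡⟨ hit ⟩
    c               ≡⟨ sym (m<n⇒m%n≡m (<-trans (<⇒≤ j₀<t) t<s)) ⟩
    c % s           ≡⟨ cong (_% s) (sym (+-identityʳ c)) ⟩
    (c + 0) % s     ∎

proper⇒degree≤labels : (G : Graph) {d m : ℕ} {c : EdgeLabeling G d} → IsProper G c →
                       (u : Fin (n G)) (nb : Fin m → Fin (n G)) → Injective _≡_ _≡_ nb →
                       (∀ i → Adj G u (nb i)) → m ≤ d
proper⇒degree≤labels G {c = c} proper u nb nb-injective adj = injective⇒≤ labels-injective
  where
  labels-injective : Injective _≡_ _≡_ (λ i → c u (nb i))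
  labels-injective {i} {j} same = decidable-stable (i ≟ᶠ j) λ i≢j →
    proper u (nb i) (nb j) (adj i) (adj j) (λ e → i≢j (nb-injective e)) same

perm-injective : ∀ {m} (f : Permutation′ m) → Injective _≡_ _≡_ (f ⟨$⟩ʳ_)
perm-injective f e = trans (sym (inverseˡ f)) (trans (cong (f ⟨$⟩ˡ_) e) (inverseˡ f))

module Bipartite (s t : ℕ) where

  InA InB : Fin (s + t) → Set
  InA v = toℕ v < s
  InB v = s ≤ toℕ v

  offset : Fin (s + t) → ℕ
  offset v = toℕ v ∸ s

  a : Fin s → Fin (s + t)
  a i = i ↑ˡ t

  b : Fin t → Fin (s + t)
  b j = s ↑ʳ j

  toℕ-a : ∀ i → toℕ (a i) ≡ toℕ i
  toℕ-a i = toℕ-↑ˡ i t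

  a-inA : ∀ i → InA (a i)
  a-inA i = subst (_< s) (sym (toℕ-a i)) (toℕ<n i)

  b-inB : ∀ j → InB (b j)
  b-inB j = subst (s ≤_) (sym (toℕ-↑ʳ s j)) (m≤m+n s (toℕ j))

  offset-b : ∀ j → offset (b j) ≡ toℕ j
  offset-b j = trans (cong (_∸ s) (toℕ-↑ʳ s j)) (m+n∸m≡n s (toℕ j))

  offset-injective : ∀ {v w} → InB v → InB w → offset v ≡ offset w → v ≡ w
  offset-injective v∈B w∈B eq = toℕ-injective (∸-cancelʳ-≡ v∈B w∈B eq)

  A-B-adj : ∀ {u v} → InA u → InB v → KAdj s t u v
  A-B-adj u∈A v∈B = inj₁ (u∈A , v∈B)

  B-A-adj : ∀ {u v} → InB u → InA v → KAdj s t u v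
  B-A-adj u∈B v∈A = inj₂ (u∈B , v∈A)

  neighbour-of-A : ∀ {u v} → KAdj s t u v → InA u → InB v
  neighbour-of-A (inj₁ (_ , v∈B)) _   = v∈B
  neighbour-of-A (inj₂ (u∈B , _)) u∈A = contradiction u∈B (<⇒≱ u∈A)

  neighbour-of-B : ∀ {u v} → KAdj s t u v → InB u → InA v
  neighbour-of-B (inj₁ (u∈A , _)) u∈B = contradiction u∈B (<⇒≱ u∈A)
  neighbour-of-B (inj₂ (_ , v∈A)) _   = v∈A

  -- Lower bound: a vertex of B has the s vertices of A as neighbours.
  labels-needed : 1 ≤ t → ∀ d → d < s → ¬ HasDistEdgeLabeling (K s t) d
  labels-needed 1≤t d d<s (c , _ , proper , _) =
    <⇒≱ d<s (proper⇒degree≤labels (K s t) proper (b (fromℕ< 1≤t)) a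
      (λ {i} {j} → ↑ˡ-injective t i j) (λ i → B-A-adj (b-inB _) (a-inA i)))

  module Labeled (1≤t : 1 ≤ t) (t<s : t < s) where

    private instance
      s-nonZero : NonZero s
      s-nonZero = >-nonZero (≤-<-trans z≤n t<s)
      t-nonZero : NonZero t
      t-nonZero = >-nonZero 1≤t

    offset<t : ∀ v → offset v < t
    offset<t v = m<n+o⇒m∸n<o (toℕ v) s (toℕ<n v)

    offset<s : ∀ v → offset v < s
    offset<s v = <-trans (offset<t v) t<s

    a₀ b₀ : Fin (s + t)
    a₀ = a (fromℕ< (>-nonZero⁻¹ s))
    b₀ = b (fromℕ< 1≤t)

    toℕ-a₀ : toℕ a₀ ≡ 0
    toℕ-a₀ = trans (toℕ-a _) (toℕ-fromℕ< _)

    offset-b₀ : offset b₀ ≡ 0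
    offset-b₀ = trans (offset-b _) (toℕ-fromℕ< _)

    module SidePreserving (f : Permutation′ (s + t)) (aut : IsAutomorphism (K s t) f) where

      adj : ∀ {u v} → KAdj s t u v → KAdj s t (f ⟨$⟩ʳ u) (f ⟨$⟩ʳ v)
      adj {u} {v} = proj₁ (aut u v)

      -- If a vertex of A went to B, its neighbour b₀ would go to A and then
      -- all of A, adjacent to b₀, would be injected into the t < s places of B.
      A↦A : ∀ {u} → InA u → InA (f ⟨$⟩ʳ u)
      A↦A {u} u∈A with toℕ (f ⟨$⟩ʳ u) <? s
      ... | yes fu∈A = fu∈A
      ... | no  fu∉A = contradiction (injective⇒≤ squeeze-injective) (<⇒≱ t<s)
        where
        fb₀∈A : InA (f ⟨$⟩ʳ b₀)
        fb₀∈A = neighbour-of-B (adj (A-B-adj u∈A (b-inB _))) (≮⇒≥ fu∉A)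
        fa∈B : ∀ i → InB (f ⟨$⟩ʳ a i)
        fa∈B i = neighbour-of-A (adj (B-A-adj (b-inB _) (a-inA i))) fb₀∈A
        squeeze : Fin s → Fin t
        squeeze i = fromℕ< (offset<t (f ⟨$⟩ʳ a i))
        squeeze-injective : Injective _≡_ _≡_ squeeze
        squeeze-injective {i} {j} e = ↑ˡ-injective t i j (perm-injective f
          (offset-injective (fa∈B i) (fa∈B j) (fromℕ<-injective _ _ _ _ e)))

      B↦B : ∀ {v} → InB v → InB (f ⟨$⟩ʳ v)
      B↦B {v} v∈B = neighbour-of-A (adj {a₀} {v} (A-B-adj (a-inA _) v∈B)) (A↦A (a-inA _))

      B↤B : ∀ {v} → InB (f ⟨$⟩ʳ v) → InB v
      B↤B fv∈B = ≮⇒≥ λ v∈A → <⇒≱ (A↦A v∈A) fv∈B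

    -- The labeling: the edge {i, j} with i ∈ A and offset j ∈ B gets (i + j) mod s.
    label : EdgeLabeling (K s t) s
    label u v = fromℕ< (m%n<n (toℕ u + toℕ v ∸ s) s)

    label-sym : ∀ u v → label u v ≡ label v u
    label-sym u v = cong (λ m → fromℕ< (m%n<n (m ∸ s) s)) (+-comm (toℕ u) (toℕ v))

    toℕ-label : ∀ u {v} → InB v → toℕ (label u v) ≡ (toℕ u + offset v) % s
    toℕ-label u {v} v∈B = trans (toℕ-fromℕ< _) (cong (_% s) (+-∸-assoc (toℕ u) v∈B))

    label-≡ : ∀ {u v x w} → InB v → InB w → label u v ≡ label x w →
              (toℕ u + offset v) % s ≡ (toℕ x + offset w) % s
    label-≡ {u} {v} {x} {w} v∈B w∈B eq =
      trans (sym (toℕ-label u v∈B)) (trans (cong toℕ eq) (toℕ-label x w∈B))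

    -- Properness is injectivity of translation modulo s, seen from either side.
    label-proper : IsProper (K s t) label
    label-proper u v w uv uw v≢w same with toℕ u <? s
    ... | yes u∈A = v≢w (offset-injective v∈B w∈B
            (+-%-cancelˡ (toℕ u) (offset<s v) (offset<s w) (label-≡ v∈B w∈B same)))
      where
      v∈B = neighbour-of-A uv u∈A
      w∈B = neighbour-of-A uw u∈A
    ... | no u∉A = v≢w (toℕ-injective
            (+-%-cancelʳ (offset u) (neighbour-of-B uv u∈B) (neighbour-of-B uw u∈B)
              (label-≡ u∈B u∈B (trans (label-sym v u) (trans same (label-sym u w))))))
      where
      u∈B = ≮⇒≥ u∉A

    module Rigidity (f : Permutation′ (s + t)) (aut : IsAutomorphism (K s t) f)
                    (pres : Preserves (K s t) f label) where
      open SidePreserving f aut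
      open ≡-Reasoning

      sums-preserved : ∀ {u v} → InA u → InB v →
                       (toℕ (f ⟨$⟩ʳ u) + offset (f ⟨$⟩ʳ v)) % s ≡ (toℕ u + offset v) % s
      sums-preserved u∈A v∈B = label-≡ (B↦B v∈B) v∈B (pres _ _ (A-B-adj u∈A v∈B))

      b* : Fin (s + t)
      b* = f ⟨$⟩ˡ b₀

      b*∈B : InB b*
      b*∈B = B↤B (subst InB (sym (inverseʳ f)) (b-inB _))

      j₀ : ℕ
      j₀ = offset b*

      -- Comparing the edges {u, b*} and {f u, b₀}: f translates A by j₀.
      A-shift : ∀ {u} → InA u → toℕ (f ⟨$⟩ʳ u) ≡ (toℕ u + j₀) % s
      A-shift {u} u∈A = begin
        toℕ (f ⟨$⟩ʳ u)                      ≡⟨ sym (m<n⇒m%n≡m (A↦A u∈A)) ⟩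
        toℕ (f ⟨$⟩ʳ u) % s                  ≡⟨ cong (_% s) (sym (+-identityʳ _)) ⟩
        (toℕ (f ⟨$⟩ʳ u) + 0) % s            ≡⟨ cong (λ o → (toℕ (f ⟨$⟩ʳ u) + o) % s) fb*-offset ⟩
        (toℕ (f ⟨$⟩ʳ u) + offset (f ⟨$⟩ʳ b*)) % s ≡⟨ sums-preserved u∈A b*∈B ⟩
        (toℕ u + j₀) % s                    ∎
        where
        fb*-offset : 0 ≡ offset (f ⟨$⟩ʳ b*)
        fb*-offset = sym (trans (cong offset (inverseʳ f)) offset-b₀)

      fa₀ : toℕ (f ⟨$⟩ʳ a₀) ≡ j₀
      fa₀ = trans (A-shift (a-inA _))
              (trans (cong (λ m → (m + j₀) % s) toℕ-a₀) (m<n⇒m%n≡m (offset<s b*)))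

      -- Comparing the edges {a₀, v} and {f a₀, f v}: f translates B by -j₀.
      B-shift : ∀ {v} → InB v → (j₀ + offset (f ⟨$⟩ʳ v)) % s ≡ offset v
      B-shift {v} v∈B = begin
        (j₀ + offset (f ⟨$⟩ʳ v)) % s             ≡⟨ cong (λ m → (m + offset (f ⟨$⟩ʳ v)) % s) (sym fa₀) ⟩
        (toℕ (f ⟨$⟩ʳ a₀) + offset (f ⟨$⟩ʳ v)) % s ≡⟨ sums-preserved (a-inA _) v∈B ⟩
        (toℕ a₀ + offset v) % s                  ≡⟨ cong (λ m → (m + offset v) % s) toℕ-a₀ ⟩
        offset v % s                             ≡⟨ m<n⇒m%n≡m (offset<s v) ⟩
        offset v                                 ∎

      j₀≡0 : j₀ ≡ 0
      j₀≡0 = shift-covering⇒≡0 t<s (offset<t b*) λ j j<t →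
        let v = b (fromℕ< j<t) in
        offset (f ⟨$⟩ʳ v) , offset<t _ ,
        trans (B-shift (b-inB _)) (trans (offset-b _) (toℕ-fromℕ< j<t))

      fixes-A : ∀ {u} → InA u → f ⟨$⟩ʳ u ≡ u
      fixes-A {u} u∈A = toℕ-injective (begin
        toℕ (f ⟨$⟩ʳ u)    ≡⟨ A-shift u∈A ⟩
        (toℕ u + j₀) % s ≡⟨ cong (λ m → (toℕ u + m) % s) j₀≡0 ⟩
        (toℕ u + 0) % s  ≡⟨ cong (_% s) (+-identityʳ (toℕ u)) ⟩
        toℕ u % s        ≡⟨ m<n⇒m%n≡m u∈A ⟩
        toℕ u            ∎)

      fixes-B : ∀ {v} → InB v → f ⟨$⟩ʳ v ≡ v
      fixes-B {v} v∈B = offset-injective (B↦B v∈B) v∈B (begin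
        offset (f ⟨$⟩ʳ v)             ≡⟨ sym (m<n⇒m%n≡m (offset<s _)) ⟩
        offset (f ⟨$⟩ʳ v) % s         ≡⟨ cong (λ m → (m + offset (f ⟨$⟩ʳ v)) % s) (sym j₀≡0) ⟩
        (j₀ + offset (f ⟨$⟩ʳ v)) % s ≡⟨ B-shift v∈B ⟩
        offset v                     ∎)

      fixes-all : ∀ v → f ⟨$⟩ʳ v ≡ v
      fixes-all v with toℕ v <? s
      ... | yes v∈A = fixes-A v∈A
      ... | no  v∉A = fixes-B (≮⇒≥ v∉A)

    label-distinguishing : IsDistinguishing (K s t) label
    label-distinguishing f aut pres = Rigidity.fixes-all f aut pres

mainTheorem2 : (s t : ℕ) → 1 ≤ t → t < s → DistChromaticIndexIs (K s t) s
mainTheorem2 s t 1≤t t<s =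
  (label , (λ u v _ → label-sym u v) , label-proper , label-distinguishing) ,
  labels-needed 1≤t
  where
  open Bipartite s t
  open Labeled 1≤t t<s
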